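{- Define $\mu_n(q)$ by $\frac{\theta_{\nu+1}(x)}{\theta_\nu(x)}=\sum_{n\ge0}\mu_n(q)x^n$, where $\theta_\nu(x)=\sum_{n\ge0} q^{\binom n2}\frac{(-1)^n(xq^\nu)^n(1-q)^{2n}}{(q;q)_n(q^{\nu+1};q)_n}$. Then \[ \mu_0(q)=1, \qquad \mu_1(q)= \frac{q^\nu}{[\nu+1]_q[\nu+2]_q}, \] and for $n\ge 2$, \[ q^{ -\nu} [\nu+1]_q[\nu+n+1]_q \mu_{n}(q) = \sum_{k=2}^{n-1} q^{\nu+k} \mu_{k-1}(q)\mu_{n-k}(q) + (1+q^{\nu+n}) \mu_{n-1}(q). \]
   Context: $(a;q)_n=(1-a)(1-aq)\cdots(1-aq^{n-1})$ and $[x]_q=(1-q^x)/(1-q)$. Here $\nu$ is a parameter (not a negative integer), and the $\mu_n(q)$ are rational functions of $q$ and $q^\nu$. -}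

module Defs where

open import Level using (_⊔_; suc)
open import Data.Nat as ℕ using (ℕ; zero; suc)
open import Data.Nat.Combinatorics using (_C_)
open import Relation.Nullary using (¬_)
open import Algebra.Bundles using (CommutativeRing)

record Field (c ℓ : Level.Level) : Set (Level.suc (c ⊔ ℓ)) where
  field
    commutativeRing : CommutativeRing c ℓ
  open CommutativeRing commutativeRing public
  field
    _⁻¹        : Carrier → Carrier
    ⁻¹-inverse : ∀ x → ¬ (x ≈ 0#) → x * (x ⁻¹) ≈ 1#
    1≉0        : ¬ (1# ≈ 0#)

module FieldDefs {c ℓ} (F : Field c ℓ) where
  open Field F

  infixl 7 _/_
  _/_ : Carrier → Carrier → Carrier
  a / b = a * (b ⁻¹)

  infixr 8 _^_
  _^_ : Carrier → ℕ → Carrier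
  a ^ zero  = 1#
  a ^ suc n = a * (a ^ n)

  sumTo : ℕ → (ℕ → Carrier) → Carrier
  sumTo zero    f = 0#
  sumTo (suc n) f = sumTo n f + f n

  poch : Carrier → Carrier → ℕ → Carrier
  poch a q zero    = 1#
  poch a q (suc n) = poch a q n * (1# - a * (q ^ n))

  -- q-number [x]_q = (1 - q^x)/(1 - q), given Q = q^x
  qnum : Carrier → Carrier → Carrier
  qnum q Q = (1# - Q) / (1# - q)

  -- n-th coefficient (in x) of θ_ν(x), where t stands for q^ν:
  -- q^{C(n,2)} (-1)^n t^n (1-q)^{2n} / ((q;q)_n (t q;q)_n)
  thetaCoeff : Carrier → Carrier → ℕ → Carrier
  thetaCoeff q t n =
    (q ^ (n C 2)) * ((- 1#) ^ n) * (t ^ n) * ((1# - q) ^ (2 ℕ.* n))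
      / (poch q q n * poch (t * q) q n)

module Submission where

-- Put t = q^ν, w = tq = q^{ν+1} and k = t(1 - q)², and let a, b be the
-- coefficient sequences of θ_ν and θ_{ν+1}.  The ratio of consecutive
-- coefficients of θ_ν gives two contiguous relations between the series:
--   (1 - w) (a(qx) - a(x)) = k x b(x),   b(x) = (1 - w) a(qx) + w b(qx).
-- Substituting b = a y into them and eliminating a turns them into the
-- q-Riccati equation
--   (1 - w)(y(x) - 1) - w(1 - w)(y(qx) - 1) = k x y(x) ((1 - w) + w y(qx))
-- for y = Σ μ_n x^n, after cancelling a(x) a(qx), which has constant term 1.
-- Comparing the coefficients of x^{n+1} gives μ_0 = 1, μ_1 and the
-- quadratic recurrence.

open import Algebra.Bundles using (CommutativeRing)
open import Data.Integer using (0ℤ; 1ℤ)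
open import Data.Nat as ℕ using (ℕ; zero; suc)
import Data.Nat.Properties as ℕ
open import Data.Nat.Combinatorics using (_C_; nC1≡n; nCk+nC[k+1]≡[n+1]C[k+1])
open import Data.Product using (_×_; _,_)
open import Data.Sum using (inj₁; inj₂)
open import Function using (_∘_)
open import Relation.Binary.PropositionalEquality as ≡ using (_≡_)
open import Relation.Nullary using (¬_)

open import Defs

-- Algebra.Solver.Ring normalises with coefficients in ℤ, so it can cancel
-- x - x in an arbitrary commutative ring once given the canonical map ℤ → R.
module ℤ-CoefficientSolver {c ℓ} (R : CommutativeRing c ℓ) where
  open import Data.Integer as ℤ using (ℤ; +_; -[1+_]; _⊖_; ∣_∣; sign; _◃_)
  import Data.Integer.Properties as ℤ
  open import Data.Maybe using (Maybe; just; nothing)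
  open import Data.Sign as Sign using (Sign)
  open import Relation.Nullary using (yes; no)
  open import Algebra.Solver.Ring.AlmostCommutativeRing
    using (fromCommutativeRing; _-Raw-AlmostCommutative⟶_)
  open CommutativeRing R
  open import Relation.Binary.Reasoning.Setoid setoid
  open import Algebra.Properties.Ring ring using (-‿distribʳ-*; -1*x≈-x; -‿+-comm; -0#≈0#; -‿involutive)
  open import Algebra.Properties.CommutativeSemigroup +-commutativeSemigroup using () renaming (interchange to +-interchange)
  open import Algebra.Properties.CommutativeSemigroup *-commutativeSemigroup using () renaming (interchange to *-interchange)
  open import Algebra.Properties.Monoid.Mult.TCOptimised +-monoid using (×-homo-+) renaming (_×_ to _·_)
  open import Algebra.Properties.Semiring.Mult.TCOptimised semiring using (×1-homo-*)

  ⟦_⟧ℤ : ℤ → Carrier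
  ⟦ + n ⟧ℤ      = n · 1#
  ⟦ -[1+ n ] ⟧ℤ = - (suc n · 1#)

  ⊖-homo : ∀ m n → ⟦ m ⊖ n ⟧ℤ ≈ m · 1# - n · 1#
  ⊖-homo m       zero    = trans (sym (+-identityʳ _)) (+-congˡ (sym -0#≈0#))
  ⊖-homo zero    (suc n) = sym (+-identityˡ _)
  ⊖-homo (suc m) (suc n) = begin
    ⟦ suc m ⊖ suc n ⟧ℤ                       ≡⟨ ≡.cong ⟦_⟧ℤ (ℤ.[1+m]⊖[1+n]≡m⊖n m n) ⟩
    ⟦ m ⊖ n ⟧ℤ                               ≈⟨ ⊖-homo m n ⟩
    m · 1# - n · 1#                         ≈⟨ +-identityˡ _ ⟨
    0# + (m · 1# - n · 1#)                  ≈⟨ +-congʳ (-‿inverseʳ 1#) ⟨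
    (1# - 1#) + (m · 1# - n · 1#)           ≈⟨ +-interchange _ _ _ _ ⟨
    (1# + m · 1#) + (- 1# - n · 1#)         ≈⟨ +-congˡ (-‿+-comm 1# (n · 1#)) ⟩
    (1# + m · 1#) - (1# + n · 1#)           ≈⟨ +-cong (×-homo-+ 1# 1 m) (-‿cong (×-homo-+ 1# 1 n)) ⟨
    suc m · 1# - suc n · 1#                 ∎

  +-homo : ∀ i j → ⟦ i ℤ.+ j ⟧ℤ ≈ ⟦ i ⟧ℤ + ⟦ j ⟧ℤ
  +-homo (+ m)    (+ n)    = ×-homo-+ 1# m n
  +-homo (+ m)    -[1+ n ] = ⊖-homo m (suc n)
  +-homo -[1+ m ] (+ n)    = trans (⊖-homo n (suc m)) (+-comm _ _)
  +-homo -[1+ m ] -[1+ n ] = begin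
    - (suc (suc (m ℕ.+ n)) · 1#)     ≡⟨ ≡.cong (λ k → - (suc k · 1#)) (ℕ.+-suc m n) ⟨
    - ((suc m ℕ.+ suc n) · 1#)       ≈⟨ -‿cong (×-homo-+ 1# (suc m) (suc n)) ⟩
    - (suc m · 1# + suc n · 1#)      ≈⟨ -‿+-comm _ _ ⟨
    ⟦ -[1+ m ] ⟧ℤ + ⟦ -[1+ n ] ⟧ℤ      ∎

  -‿homo : ∀ i → ⟦ ℤ.- i ⟧ℤ ≈ - ⟦ i ⟧ℤ
  -‿homo (+ zero)  = sym -0#≈0#
  -‿homo (+ suc n) = refl
  -‿homo -[1+ n ]  = sym (-‿involutive _)

  ⟦_⟧ₛ : Sign → Carrier
  ⟦ Sign.+ ⟧ₛ = 1#
  ⟦ Sign.- ⟧ₛ = - 1#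

  ◃-homo : ∀ s n → ⟦ s ◃ n ⟧ℤ ≈ ⟦ s ⟧ₛ * (n · 1#)
  ◃-homo s       zero    = sym (zeroʳ _)
  ◃-homo Sign.+ (suc n) = sym (*-identityˡ _)
  ◃-homo Sign.- (suc n) = sym (-1*x≈-x _)

  sign-homo : ∀ s s′ → ⟦ s Sign.* s′ ⟧ₛ ≈ ⟦ s ⟧ₛ * ⟦ s′ ⟧ₛ
  sign-homo Sign.+ s′      = sym (*-identityˡ _)
  sign-homo Sign.- Sign.+ = sym (*-identityʳ _)
  sign-homo Sign.- Sign.- = trans (sym (-‿involutive 1#)) (trans (-‿cong (sym (-1*x≈-x 1#))) (-‿distribʳ-* _ _))

  *-homo : ∀ i j → ⟦ i ℤ.* j ⟧ℤ ≈ ⟦ i ⟧ℤ * ⟦ j ⟧ℤ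
  *-homo i j = begin
    ⟦ i ℤ.* j ⟧ℤ
      ≈⟨ ◃-homo (sign i Sign.* sign j) (∣ i ∣ ℕ.* ∣ j ∣) ⟩
    ⟦ sign i Sign.* sign j ⟧ₛ * ((∣ i ∣ ℕ.* ∣ j ∣) · 1#)
      ≈⟨ *-cong (sign-homo (sign i) (sign j)) (×1-homo-* ∣ i ∣ ∣ j ∣) ⟩
    (⟦ sign i ⟧ₛ * ⟦ sign j ⟧ₛ) * (∣ i ∣ · 1# * ∣ j ∣ · 1#)
      ≈⟨ *-interchange _ _ _ _ ⟩
    (⟦ sign i ⟧ₛ * ∣ i ∣ · 1#) * (⟦ sign j ⟧ₛ * ∣ j ∣ · 1#)
      ≈⟨ *-cong (◃-homo (sign i) ∣ i ∣) (◃-homo (sign j) ∣ j ∣) ⟨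
    ⟦ sign i ◃ ∣ i ∣ ⟧ℤ * ⟦ sign j ◃ ∣ j ∣ ⟧ℤ
      ≡⟨ ≡.cong₂ (λ i j → ⟦ i ⟧ℤ * ⟦ j ⟧ℤ) (ℤ.◃-inverse i) (ℤ.◃-inverse j) ⟩
    ⟦ i ⟧ℤ * ⟦ j ⟧ℤ ∎

  homomorphism : ℤ.+-*-rawRing -Raw-AlmostCommutative⟶ fromCommutativeRing R
  homomorphism = record
    { ⟦_⟧ = ⟦_⟧ℤ ; +-homo = +-homo ; *-homo = *-homo ; -‿homo = -‿homo
    ; 0-homo = refl ; 1-homo = refl }

  _≟⟦⟧_ : ∀ i j → Maybe (⟦ i ⟧ℤ ≈ ⟦ j ⟧ℤ)
  i ≟⟦⟧ j with i ℤ.≟ j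
  ... | yes ≡.refl = just refl
  ... | no _       = nothing

  open import Algebra.Solver.Ring ℤ.+-*-rawRing (fromCommutativeRing R) homomorphism _≟⟦⟧_
    public using (solve; _:=_; con; _:+_; _:*_; _:-_; :-_)

module PowerSeries {c ℓ} (R : CommutativeRing c ℓ) where
  open CommutativeRing R
  open import Relation.Binary.Reasoning.Setoid setoid
  open ℤ-CoefficientSolver R

  Series : Set c
  Series = ℕ → Carrier

  infix  4 _≋_
  infixl 6 _⊕_ _⊖_
  infixl 7 _⊛_
  infix  8 ⊝_

  _≋_ : Series → Series → Set ℓ
  f ≋ g = ∀ n → f n ≈ g n

  _⊕_ : Series → Series → Series
  (f ⊕ g) n = f n + g n

  ⊝_ : Series → Series
  (⊝ f) n = - f n

  _⊖_ : Series → Series → Series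
  f ⊖ g = f ⊕ ⊝ g

  𝟘 : Series
  𝟘 _ = 0#

  const : Carrier → Series
  const a zero    = a
  const a (suc n) = 0#

  X : Series
  X zero    = 0#
  X (suc n) = const 1# n

  tail : Series → Series
  tail f n = f (suc n)

  _⊛_ : Series → Series → Series
  (f ⊛ g) zero    = f 0 * g 0
  (f ⊛ g) (suc n) = f 0 * g (suc n) + (tail f ⊛ g) n

  ⊛-cong : ∀ {f f′ g g′} → f ≋ f′ → g ≋ g′ → f ⊛ g ≋ f′ ⊛ g′
  ⊛-cong f≋f′ g≋g′ zero    = *-cong (f≋f′ 0) (g≋g′ 0)
  ⊛-cong f≋f′ g≋g′ (suc n) = +-cong (*-cong (f≋f′ 0) (g≋g′ (suc n))) (⊛-cong (f≋f′ ∘ suc) g≋g′ n)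

  ⊛-zeroˡ : ∀ g n → (𝟘 ⊛ g) n ≈ 0#
  ⊛-zeroˡ g zero    = zeroˡ _
  ⊛-zeroˡ g (suc n) = trans (+-cong (zeroˡ _) (⊛-zeroˡ g n)) (+-identityˡ 0#)

  const-⊛ : ∀ a g n → (const a ⊛ g) n ≈ a * g n
  const-⊛ a g zero    = refl
  const-⊛ a g (suc n) = trans (+-congˡ (⊛-zeroˡ g n)) (+-identityʳ _)

  ⊛-scaleˡ : ∀ a f g n → ((λ k → a * f k) ⊛ g) n ≈ a * (f ⊛ g) n
  ⊛-scaleˡ a f g zero    = *-assoc _ _ _
  ⊛-scaleˡ a f g (suc n) =
    trans (+-cong (*-assoc _ _ _) (⊛-scaleˡ a (tail f) g n)) (sym (distribˡ _ _ _))

  ⊛-distribʳ : ∀ f g h n → ((f ⊕ g) ⊛ h) n ≈ (f ⊛ h) n + (g ⊛ h) n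
  ⊛-distribʳ f g h zero    = distribʳ _ _ _
  ⊛-distribʳ f g h (suc n) = begin
    (f 0 + g 0) * h (suc n) + ((tail f ⊕ tail g) ⊛ h) n
      ≈⟨ +-cong (distribʳ _ _ _) (⊛-distribʳ (tail f) (tail g) h n) ⟩
    (f 0 * h (suc n) + g 0 * h (suc n)) + ((tail f ⊛ h) n + (tail g ⊛ h) n)
      ≈⟨ solve 4 (λ a b c d → (a :+ b) :+ (c :+ d) := (a :+ c) :+ (b :+ d)) refl _ _ _ _ ⟩
    (f ⊛ h) (suc n) + (g ⊛ h) (suc n) ∎

  ⊛-sucʳ : ∀ f g n → (f ⊛ g) (suc n) ≈ (f ⊛ tail g) n + f (suc n) * g 0
  ⊛-sucʳ f g zero    = refl
  ⊛-sucʳ f g (suc n) =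
    trans (+-congˡ (⊛-sucʳ (tail f) g n)) (sym (+-assoc _ _ _))

  ⊛-comm : ∀ f g n → (f ⊛ g) n ≈ (g ⊛ f) n
  ⊛-comm f g zero    = *-comm _ _
  ⊛-comm f g (suc n) = begin
    f 0 * g (suc n) + (tail f ⊛ g) n  ≈⟨ +-cong (*-comm _ _) (⊛-comm (tail f) g n) ⟩
    g (suc n) * f 0 + (g ⊛ tail f) n  ≈⟨ +-comm _ _ ⟩
    (g ⊛ tail f) n + g (suc n) * f 0  ≈⟨ ⊛-sucʳ g f n ⟨
    (g ⊛ f) (suc n)                    ∎

  ⊛-assoc : ∀ f g h n → ((f ⊛ g) ⊛ h) n ≈ (f ⊛ (g ⊛ h)) n
  ⊛-assoc f g h zero    = *-assoc _ _ _
  ⊛-assoc f g h (suc n) = begin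
    (f 0 * g 0) * h (suc n) + (tail (f ⊛ g) ⊛ h) n
      ≈⟨ +-congˡ (⊛-distribʳ (λ k → f 0 * g (suc k)) (tail f ⊛ g) h n) ⟩
    (f 0 * g 0) * h (suc n) + (((λ k → f 0 * g (suc k)) ⊛ h) n + ((tail f ⊛ g) ⊛ h) n)
      ≈⟨ +-congˡ (+-cong (⊛-scaleˡ (f 0) (tail g) h n) (⊛-assoc (tail f) g h n)) ⟩
    (f 0 * g 0) * h (suc n) + (f 0 * (tail g ⊛ h) n + (tail f ⊛ (g ⊛ h)) n)
      ≈⟨ solve 5 (λ a b c d e → (a :* b) :* c :+ (a :* d :+ e) := a :* (b :* c :+ d) :+ e) refl _ _ _ _ _ ⟩
    (f ⊛ (g ⊛ h)) (suc n) ∎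

  powerSeriesRing : CommutativeRing c ℓ
  powerSeriesRing = record
    { Carrier = Series ; _≈_ = _≋_ ; _+_ = _⊕_ ; _*_ = _⊛_ ; -_ = ⊝_ ; 0# = 𝟘 ; 1# = const 1#
    ; isCommutativeRing = record
      { isRing = record
        { +-isAbelianGroup = record
          { isGroup = record
            { isMonoid = record
              { isSemigroup = record
                { isMagma = record
                  { isEquivalence = record
                    { refl = λ _ → refl ; sym = λ p n → sym (p n) ; trans = λ p q n → trans (p n) (q n) }
                  ; ∙-cong = λ p q n → +-cong (p n) (q n) }
                ; assoc = λ f g h n → +-assoc _ _ _ }
              ; identity = (λ f n → +-identityˡ _) , (λ f n → +-identityʳ _) }
            ; inverse = (λ f n → -‿inverseˡ _) , (λ f n → -‿inverseʳ _)
            ; ⁻¹-cong = λ p n → -‿cong (p n) }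
          ; comm = λ f g n → +-comm _ _ }
        ; *-cong = ⊛-cong
        ; *-assoc = ⊛-assoc
        ; *-identity = (λ f n → trans (const-⊛ 1# f n) (*-identityˡ _))
                     , (λ f n → trans (⊛-comm f (const 1#) n) (trans (const-⊛ 1# f n) (*-identityˡ _)))
        ; distrib = (λ f g h n → trans (⊛-comm f (g ⊕ h) n)
                                   (trans (⊛-distribʳ g h f n) (+-cong (⊛-comm g f n) (⊛-comm h f n))))
                  , (λ f g h n → ⊛-distribʳ g h f n) }
      ; *-comm = ⊛-comm } }

  const-⊖-⊛ : ∀ a b g n → ((const a ⊖ const b) ⊛ g) n ≈ (a - b) * g n
  const-⊖-⊛ a b g n = trans (⊛-cong const-⊖ (λ _ → refl) n) (const-⊛ (a - b) g n)
    where
    const-⊖ : const a ⊖ const b ≋ const (a - b)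
    const-⊖ zero    = refl
    const-⊖ (suc n) = -‿inverseʳ 0#

  X-⊛ : ∀ g n → (X ⊛ g) (suc n) ≈ g n
  X-⊛ g n = begin
    0# * g (suc n) + (const 1# ⊛ g) n  ≈⟨ +-cong (zeroˡ _) (const-⊛ 1# g n) ⟩
    0# + 1# * g n                      ≈⟨ +-identityˡ _ ⟩
    1# * g n                           ≈⟨ *-identityˡ _ ⟩
    g n                                ∎

  ⊛-vanishing : ∀ f g n → (∀ k → k ℕ.≤ n → g k ≈ 0#) → (f ⊛ g) n ≈ 0#
  ⊛-vanishing f g zero    g≈0 = trans (*-congˡ (g≈0 0 ℕ.z≤n)) (zeroʳ _)
  ⊛-vanishing f g (suc n) g≈0 = trans
    (+-cong (*-congˡ (g≈0 (suc n) ℕ.≤-refl)) (⊛-vanishing (tail f) g n (λ k k≤n → g≈0 k (ℕ.m≤n⇒m≤1+n k≤n))))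
    (trans (+-congʳ (zeroʳ _)) (+-identityˡ 0#))

  -- (f ⊛ g) n is f 0 * g n plus terms in g 0, …, g (n - 1), so the
  -- coefficients of g vanish one by one.
  ⊛≋0⇒≋0 : ∀ {f g} → f 0 ≈ 1# → f ⊛ g ≋ 𝟘 → g ≋ 𝟘
  ⊛≋0⇒≋0 {f} {g} f₀≈1 fg≋0 n = vanishesUpTo n n ℕ.≤-refl
    where
    leading : ∀ n → g n ≈ f 0 * g n
    leading n = trans (sym (*-identityˡ _)) (*-congʳ (sym f₀≈1))

    vanishesUpTo : ∀ n k → k ℕ.≤ n → g k ≈ 0#
    vanishesUpTo zero    zero    ℕ.z≤n = trans (leading 0) (fg≋0 0)
    vanishesUpTo (suc n) k       k≤1+n with ℕ.m≤n⇒m<n∨m≡n k≤1+n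
    ... | inj₁ (ℕ.s≤s k≤n) = vanishesUpTo n k k≤n
    ... | inj₂ ≡.refl      = begin
      g (suc n)                                ≈⟨ leading (suc n) ⟩
      f 0 * g (suc n)                          ≈⟨ +-identityʳ _ ⟨
      f 0 * g (suc n) + 0#                     ≈⟨ +-congˡ (⊛-vanishing (tail f) g n (vanishesUpTo n)) ⟨
      (f ⊛ g) (suc n)                          ≈⟨ fg≋0 (suc n) ⟩
      0#                                       ∎

-- Read a, a′, b, b′ as θ_ν(x), θ_ν(qx), θ_{ν+1}(x), θ_{ν+1}(qx) and y, y′ as
-- their quotients; the two linear hypotheses are the contiguous relations
-- of the theta series, the conclusion is the q-Riccati equation of y.
module QuotientRiccati {c ℓ} (R : CommutativeRing c ℓ) where
  open CommutativeRing R
  open import Relation.Binary.Reasoning.Setoid setoid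
  open import Algebra.Properties.Ring ring using (x≈y⇒x∙y⁻¹≈ε)
  open ℤ-CoefficientSolver R

  riccati : (w k x y y′ : Carrier) → Carrier
  riccati w k x y y′ =
    (1# - w) * (y - 1#) - w * ((1# - w) * (y′ - 1#)) - k * (x * ((1# - w) * y + w * (y′ * y)))

  quotient-riccati : ∀ {w k x a a′ b b′ y y′} →
    a * y ≈ b → a′ * y′ ≈ b′ →
    (1# - w) * a′ + w * b′ ≈ b → (1# - w) * (a′ - a) ≈ k * (x * b) →
    a * a′ * riccati w k x y y′ ≈ 0#
  quotient-riccati {w} {k} {x} {a} {a′} {b} {_} {y} {y′} ay≈b a′y′≈b′ split step = begin
    a * a′ * riccati w k x y y′
      ≈⟨ solve 7 (λ w k x a a′ y y′ →
           a :* a′ :* ((con 1ℤ :- w) :* (y :- con 1ℤ) :- w :* ((con 1ℤ :- w) :* (y′ :- con 1ℤ))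
                        :- k :* (x :* ((con 1ℤ :- w) :* y :+ w :* (y′ :* y))))
           := a :* y :* ((con 1ℤ :- w) :* a′ :- k :* (x :* ((con 1ℤ :- w) :* a′ :+ w :* (a′ :* y′))))
              :- (con 1ℤ :- w) :* a :* ((con 1ℤ :- w) :* a′ :+ w :* (a′ :* y′)))
           refl w k x a a′ y y′ ⟩
    a * y * ((1# - w) * a′ - k * (x * z)) - (1# - w) * a * z
      ≈⟨ +-cong (*-cong ay≈b (+-congˡ (-‿cong (*-congˡ (*-congˡ z≈b))))) (-‿cong (*-congˡ z≈b)) ⟩
    b * ((1# - w) * a′ - k * (x * b)) - (1# - w) * a * b
      ≈⟨ solve 6 (λ w k x a a′ b →
           b :* ((con 1ℤ :- w) :* a′ :- k :* (x :* b)) :- (con 1ℤ :- w) :* a :* b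
           := b :* ((con 1ℤ :- w) :* (a′ :- a) :- k :* (x :* b)))
           refl w k x a a′ b ⟩
    b * ((1# - w) * (a′ - a) - k * (x * b))
      ≈⟨ *-congˡ (x≈y⇒x∙y⁻¹≈ε step) ⟩
    b * 0#
      ≈⟨ zeroʳ b ⟩
    0# ∎
    where
    z : Carrier
    z = (1# - w) * a′ + w * (a′ * y′)

    z≈b : z ≈ b
    z≈b = trans (+-congˡ (*-congˡ a′y′≈b′)) split

module FieldProperties {c ℓ} (F : Field c ℓ) where
  open Field F
  open FieldDefs F
  open import Relation.Binary.Reasoning.Setoid setoid
  open ℤ-CoefficientSolver commutativeRing

  ⁻¹-inverseˡ : ∀ {x} → ¬ (x ≈ 0#) → x ⁻¹ * x ≈ 1#
  ⁻¹-inverseˡ {x} x≉0 = trans (*-comm _ _) (⁻¹-inverse x x≉0)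

  x*y/y≈x : ∀ x {y} → ¬ (y ≈ 0#) → x * y / y ≈ x
  x*y/y≈x x {y} y≉0 = trans (*-assoc _ _ _) (trans (*-congˡ (⁻¹-inverse y y≉0)) (*-identityʳ x))

  x/y*y≈x : ∀ x {y} → ¬ (y ≈ 0#) → x / y * y ≈ x
  x/y*y≈x x {y} y≉0 = trans (*-assoc _ _ _) (trans (*-congˡ (⁻¹-inverseˡ y≉0)) (*-identityʳ x))

  *≈⇒≈/ : ∀ {x y z} → ¬ (x ≈ 0#) → x * y ≈ z → y ≈ z / x
  *≈⇒≈/ {x} {y} x≉0 xy≈z = trans (sym (x*y/y≈x y x≉0)) (*-congʳ (trans (*-comm y x) xy≈z))

  *-≉0 : ∀ {x y} → ¬ (x ≈ 0#) → ¬ (y ≈ 0#) → ¬ (x * y ≈ 0#)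
  *-≉0 {x} {y} x≉0 y≉0 xy≈0 = y≉0 (begin
    y             ≈⟨ *≈⇒≈/ x≉0 refl ⟩
    x * y / x     ≈⟨ *-congʳ xy≈0 ⟩
    0# * x ⁻¹     ≈⟨ zeroˡ _ ⟩
    0#            ∎)

  x*y′≈x′*y⇒x/y≈x′/y′ : ∀ {x y x′ y′} → ¬ (y ≈ 0#) → ¬ (y′ ≈ 0#) → x * y′ ≈ x′ * y → x / y ≈ x′ / y′
  x*y′≈x′*y⇒x/y≈x′/y′ {x} {y} {x′} {y′} y≉0 y′≉0 xy′≈x′y = *≈⇒≈/ y′≉0 (begin
    y′ * (x / y)   ≈⟨ solve 3 (λ x y′ y⁻¹ → y′ :* (x :* y⁻¹) := x :* y′ :* y⁻¹) refl x y′ (y ⁻¹) ⟩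
    x * y′ / y     ≈⟨ *-congʳ xy′≈x′y ⟩
    x′ * y / y     ≈⟨ x*y/y≈x x′ y≉0 ⟩
    x′             ∎)

  ^-+ : ∀ x m n → x ^ (m ℕ.+ n) ≈ x ^ m * x ^ n
  ^-+ x zero    n = sym (*-identityˡ _)
  ^-+ x (suc m) n = trans (*-congˡ (^-+ x m n)) (sym (*-assoc _ _ _))

  ^-distrib-* : ∀ x y n → (x * y) ^ n ≈ x ^ n * y ^ n
  ^-distrib-* x y zero    = sym (*-identityˡ 1#)
  ^-distrib-* x y (suc n) = trans (*-congˡ (^-distrib-* x y n))
    (solve 4 (λ x y xⁿ yⁿ → x :* y :* (xⁿ :* yⁿ) := x :* xⁿ :* (y :* yⁿ)) refl x y (x ^ n) (y ^ n))

  poch-shift : ∀ a q n → poch a q (suc n) ≈ (1# - a) * poch (a * q) q n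
  poch-shift a q zero    = solve 1 (λ a → con 1ℤ :* (con 1ℤ :- a :* con 1ℤ) := (con 1ℤ :- a) :* con 1ℤ) refl a
  poch-shift a q (suc n) = begin
    poch a q (suc n) * (1# - a * q ^ suc n)              ≈⟨ *-congʳ (poch-shift a q n) ⟩
    (1# - a) * poch (a * q) q n * (1# - a * (q * q ^ n))
      ≈⟨ solve 4 (λ a q qⁿ p → (con 1ℤ :- a) :* p :* (con 1ℤ :- a :* (q :* qⁿ))
                              := (con 1ℤ :- a) :* (p :* (con 1ℤ :- a :* q :* qⁿ))) refl a q (q ^ n) (poch (a * q) q n) ⟩
    (1# - a) * poch (a * q) q (suc n)                     ∎

  poch-≉0 : ∀ {a q} → (∀ j → ¬ (1# - a * q ^ j ≈ 0#)) → ∀ n → ¬ (poch a q n ≈ 0#)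
  poch-≉0 factor≉0 zero    = 1≉0
  poch-≉0 factor≉0 (suc n) = *-≉0 (poch-≉0 factor≉0 n) (factor≉0 n)

module PowerSeriesOverField {c ℓ} (F : Field c ℓ) where
  open Field F
  open FieldDefs F
  open import Relation.Binary.Reasoning.Setoid setoid
  open ℤ-CoefficientSolver commutativeRing
  open PowerSeries commutativeRing

  sumTo-cong : ∀ n {f g} → (∀ k → f k ≈ g k) → sumTo n f ≈ sumTo n g
  sumTo-cong zero    f≈g = refl
  sumTo-cong (suc n) f≈g = +-cong (sumTo-cong n f≈g) (f≈g n)

  *-distribˡ-sumTo : ∀ a n f → a * sumTo n f ≈ sumTo n (λ k → a * f k)
  *-distribˡ-sumTo a zero    f = zeroʳ a
  *-distribˡ-sumTo a (suc n) f = trans (distribˡ _ _ _) (+-congʳ (*-distribˡ-sumTo a n f))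

  sumTo-suc : ∀ n f → sumTo (suc n) f ≈ f 0 + sumTo n (f ∘ suc)
  sumTo-suc zero    f = trans (+-identityˡ _) (sym (+-identityʳ _))
  sumTo-suc (suc n) f = trans (+-congʳ (sumTo-suc n f)) (+-assoc _ _ _)

  ⊛-sumTo : ∀ f g n → (f ⊛ g) n ≈ sumTo (suc n) (λ k → f k * g (n ℕ.∸ k))
  ⊛-sumTo f g zero    = sym (+-identityˡ _)
  ⊛-sumTo f g (suc n) =
    trans (+-congˡ (⊛-sumTo (tail f) g n)) (sym (sumTo-suc (suc n) (λ k → f k * g (suc n ℕ.∸ k))))

  ⊛-suc-sumTo : ∀ f g m →
    (f ⊛ g) (suc m) ≈ f 0 * g (suc m) + (sumTo m (λ j → f (suc j) * g (m ℕ.∸ j)) + f (suc m) * g 0)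
  ⊛-suc-sumTo f g m = +-congˡ (trans (⊛-sumTo (tail f) g m)
    (+-congˡ (*-congˡ (reflexive (≡.cong g (ℕ.n∸n≡0 m))))))

  dilate : Carrier → Series → Series
  dilate d f n = d ^ n * f n

  dilate-⊛ : ∀ d f g → dilate d (f ⊛ g) ≋ dilate d f ⊛ dilate d g
  dilate-⊛ d f g zero    =
    solve 2 (λ f₀ g₀ → con 1ℤ :* (f₀ :* g₀) := con 1ℤ :* f₀ :* (con 1ℤ :* g₀)) refl (f 0) (g 0)
  dilate-⊛ d f g (suc n) = sym (begin
    (dilate d f ⊛ dilate d g) (suc n)
      ≈⟨ +-congˡ (⊛-cong (λ k → *-assoc d (d ^ k) (f (suc k))) (λ _ → refl) n) ⟩
    1# * f 0 * (d * d ^ n * g (suc n)) + ((λ k → d * dilate d (tail f) k) ⊛ dilate d g) n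
      ≈⟨ +-congˡ (⊛-scaleˡ d (dilate d (tail f)) (dilate d g) n) ⟩
    1# * f 0 * (d * d ^ n * g (suc n)) + d * (dilate d (tail f) ⊛ dilate d g) n
      ≈⟨ +-congˡ (*-congˡ (dilate-⊛ d (tail f) g n)) ⟨
    1# * f 0 * (d * d ^ n * g (suc n)) + d * (d ^ n * (tail f ⊛ g) n)
      ≈⟨ solve 5 (λ d dⁿ f₀ g₁ h → con 1ℤ :* f₀ :* (d :* dⁿ :* g₁) :+ d :* (dⁿ :* h)
                                  := d :* dⁿ :* (f₀ :* g₁ :+ h)) refl d (d ^ n) (f 0) (g (suc n)) ((tail f ⊛ g) n) ⟩
    dilate d (f ⊛ g) (suc n) ∎)

module Theta {c ℓ} (F : Field c ℓ) where
  open Field F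
  open FieldDefs F
  open import Relation.Binary.Reasoning.Setoid setoid
  open ℤ-CoefficientSolver commutativeRing
  open import Algebra.Properties.Ring ring using (x∙y⁻¹≈ε⇒x≈y)
  open FieldProperties F
  open PowerSeries commutativeRing
  open PowerSeriesOverField F
  open QuotientRiccati powerSeriesRing using (riccati; quotient-riccati)

  -- thetaCoeff q t n is definitionally thetaNum q t n / (poch q q n * poch (t * q) q n).
  thetaNum : Carrier → Carrier → ℕ → Carrier
  thetaNum q t n = q ^ (n C 2) * (- 1#) ^ n * t ^ n * (1# - q) ^ (2 ℕ.* n)

  thetaCoeff-zero : ∀ q t → thetaCoeff q t 0 ≈ 1#
  thetaCoeff-zero q t = begin
    thetaCoeff q t 0            ≈⟨ *-identityʳ _ ⟨
    thetaCoeff q t 0 * 1#       ≈⟨ *-congˡ (*-identityʳ 1#) ⟨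
    thetaCoeff q t 0 * (1# * 1#) ≈⟨ x/y*y≈x (thetaNum q t 0) (*-≉0 1≉0 1≉0) ⟩
    1# * 1# * 1# * 1#           ≈⟨ solve 0 (con 1ℤ :* con 1ℤ :* con 1ℤ :* con 1ℤ := con 1ℤ) refl ⟩
    1#                          ∎

  thetaNum-dilate : ∀ q t n → thetaNum q (t * q) n ≈ q ^ n * thetaNum q t n
  thetaNum-dilate q t n = begin
    qᶜ * s * (t * q) ^ n * r     ≈⟨ *-congʳ (*-congˡ (^-distrib-* t q n)) ⟩
    qᶜ * s * (t ^ n * q ^ n) * r ≈⟨ solve 5 (λ qᶜ s tⁿ qⁿ r → qᶜ :* s :* (tⁿ :* qⁿ) :* r := qⁿ :* (qᶜ :* s :* tⁿ :* r))
                                      refl qᶜ s (t ^ n) (q ^ n) r ⟩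
    q ^ n * thetaNum q t n       ∎
    where
    qᶜ s r : Carrier
    qᶜ = q ^ (n C 2)
    s = (- 1#) ^ n
    r = (1# - q) ^ (2 ℕ.* n)

  suc-C2 : ∀ n → suc n C 2 ≡ n C 2 ℕ.+ n
  suc-C2 n = ≡.trans (≡.sym (nCk+nC[k+1]≡[n+1]C[k+1] n 1))
                     (≡.trans (≡.cong (ℕ._+ n C 2) (nC1≡n n)) (ℕ.+-comm n (n C 2)))

  thetaNum-suc : ∀ q t n → thetaNum q t (suc n) ≈ - (t * (1# - q) * (1# - q) * thetaNum q (t * q) n)
  thetaNum-suc q t n = begin
    q ^ (suc n C 2) * (- 1# * s) * (t * t ^ n) * (1# - q) ^ (2 ℕ.* suc n)
      ≈⟨ *-cong (*-congʳ (*-congʳ (trans (reflexive (≡.cong (q ^_) (suc-C2 n))) (^-+ q (n C 2) n))))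
                (reflexive (≡.cong ((1# - q) ^_) (ℕ.*-suc 2 n))) ⟩
    qᶜ * q ^ n * (- 1# * s) * (t * t ^ n) * ((1# - q) * ((1# - q) * r))
      ≈⟨ solve 7 (λ qᶜ qⁿ s t tⁿ q r →
           qᶜ :* qⁿ :* (:- con 1ℤ :* s) :* (t :* tⁿ) :* ((con 1ℤ :- q) :* ((con 1ℤ :- q) :* r))
           := :- (t :* (con 1ℤ :- q) :* (con 1ℤ :- q) :* (qᶜ :* s :* (tⁿ :* qⁿ) :* r)))
           refl qᶜ (q ^ n) s t (t ^ n) q r ⟩
    - (t * (1# - q) * (1# - q) * (qᶜ * s * (t ^ n * q ^ n) * r))
      ≈⟨ -‿cong (*-congˡ (*-congʳ (*-congˡ (^-distrib-* t q n)))) ⟨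
    - (t * (1# - q) * (1# - q) * thetaNum q (t * q) n) ∎
    where
    qᶜ s r : Carrier
    qᶜ = q ^ (n C 2)
    s = (- 1#) ^ n
    r = (1# - q) ^ (2 ℕ.* n)

  module Ratio (q t : Carrier) (t≉0 : ¬ (t ≈ 0#))
    (1-qⁿ⁺¹≉0 : ∀ n → ¬ ((1# - q ^ suc n) ≈ 0#))
    (1-tqⁿ⁺¹≉0 : ∀ n → ¬ ((1# - t * q ^ suc n) ≈ 0#)) where

    -- qnum q Q is definitionally (1# - Q) * i.
    w k i : Carrier
    w = t * q
    k = t * (1# - q) * (1# - q)
    i = (1# - q) ⁻¹

    a b : Series
    a = thetaCoeff q t
    b = thetaCoeff q w

    1-q≉0 : ¬ (1# - q ≈ 0#)
    1-q≉0 = 1-qⁿ⁺¹≉0 0 ∘ trans (+-congˡ (-‿cong (*-identityʳ q)))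

    i*i*k≈t : i * i * k ≈ t
    i*i*k≈t = begin
      i * i * k                          ≈⟨ solve 3 (λ t q i → i :* i :* (t :* (con 1ℤ :- q) :* (con 1ℤ :- q))
                                                           := t :* ((con 1ℤ :- q) :* i) :* ((con 1ℤ :- q) :* i)) refl t q i ⟩
      t * ((1# - q) * i) * ((1# - q) * i) ≈⟨ *-cong (*-congˡ (⁻¹-inverse _ 1-q≉0)) (⁻¹-inverse _ 1-q≉0) ⟩
      t * 1# * 1#                        ≈⟨ trans (*-identityʳ _) (*-identityʳ t) ⟩
      t                                  ∎

    P u v : ℕ → Carrier
    P = poch q q
    u = poch w q
    v = poch (w * q) q

    P≉0 : ∀ n → ¬ (P n ≈ 0#)
    P≉0 = poch-≉0 1-qⁿ⁺¹≉0

    u≉0 : ∀ n → ¬ (u n ≈ 0#)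
    u≉0 = poch-≉0 λ j → 1-tqⁿ⁺¹≉0 j ∘ trans (+-congˡ (-‿cong (sym (*-assoc t q (q ^ j)))))

    v≉0 : ∀ n → ¬ (v n ≈ 0#)
    v≉0 = poch-≉0 λ j → 1-tqⁿ⁺¹≉0 (suc j) ∘ trans (+-congˡ (-‿cong
      (solve 3 (λ t q qʲ → t :* (q :* (q :* qʲ)) := t :* q :* q :* qʲ) refl t q (q ^ j))))

    θ-dilate : ∀ n → (1# - w * q ^ n) * b n ≈ (1# - w) * (q ^ n * a n)
    θ-dilate n = begin
      (1# - w * q ^ n) * (N′ / (P n * v n))  ≈⟨ *-assoc _ _ _ ⟨
      (1# - w * q ^ n) * N′ / (P n * v n)    ≈⟨ x*y′≈x′*y⇒x/y≈x′/y′ (*-≉0 (P≉0 n) (v≉0 n)) (*-≉0 (P≉0 n) (u≉0 n)) cross ⟩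
      (1# - w) * (q ^ n * N) / (P n * u n)   ≈⟨ trans (*-assoc _ _ _) (*-congˡ (*-assoc _ _ _)) ⟩
      (1# - w) * (q ^ n * a n)               ∎
      where
      N N′ : Carrier
      N = thetaNum q t n
      N′ = thetaNum q w n

      cross : (1# - w * q ^ n) * N′ * (P n * u n) ≈ (1# - w) * (q ^ n * N) * (P n * v n)
      cross = begin
        (1# - w * q ^ n) * N′ * (P n * u n)           ≈⟨ *-congʳ (*-congˡ (thetaNum-dilate q t n)) ⟩
        (1# - w * q ^ n) * (q ^ n * N) * (P n * u n)
          ≈⟨ solve 4 (λ c qⁿN p u → c :* qⁿN :* (p :* u) := qⁿN :* p :* (c :* u)) refl (1# - w * q ^ n) (q ^ n * N) (P n) (u n) ⟩
        q ^ n * N * P n * ((1# - w * q ^ n) * u n)    ≈⟨ *-congˡ (trans (*-comm _ _) (poch-shift w q n)) ⟩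
        q ^ n * N * P n * ((1# - w) * v n)
          ≈⟨ solve 4 (λ c qⁿN p v → qⁿN :* p :* (c :* v) := c :* qⁿN :* (p :* v)) refl (1# - w) (q ^ n * N) (P n) (v n) ⟩
        (1# - w) * (q ^ n * N) * (P n * v n)          ∎

    θ-split : ∀ n → (1# - w) * (q ^ n * a n) + w * (q ^ n * b n) ≈ b n
    θ-split n = begin
      (1# - w) * (q ^ n * a n) + w * (q ^ n * b n) ≈⟨ +-congʳ (θ-dilate n) ⟨
      (1# - w * q ^ n) * b n + w * (q ^ n * b n)   ≈⟨ solve 3 (λ w qⁿ b → (con 1ℤ :- w :* qⁿ) :* b :+ w :* (qⁿ :* b) := b)
                                                        refl w (q ^ n) (b n) ⟩
      b n                                          ∎

    θ-step : ∀ n → (1# - w) * (q ^ suc n * a (suc n) - a (suc n)) ≈ k * b n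
    θ-step n = begin
      (1# - w) * (q ^ suc n * (N₁ / D₁) - N₁ / D₁)
        ≈⟨ solve 4 (λ w qⁿ⁺¹ N₁ D₁⁻¹ → (con 1ℤ :- w) :* (qⁿ⁺¹ :* (N₁ :* D₁⁻¹) :- N₁ :* D₁⁻¹)
                                      := (con 1ℤ :- w) :* (qⁿ⁺¹ :- con 1ℤ) :* N₁ :* D₁⁻¹) refl w (q ^ suc n) N₁ (D₁ ⁻¹) ⟩
      (1# - w) * (q ^ suc n - 1#) * N₁ / D₁
        ≈⟨ x*y′≈x′*y⇒x/y≈x′/y′ (*-≉0 (P≉0 (suc n)) (u≉0 (suc n))) (*-≉0 (P≉0 n) (v≉0 n)) cross ⟩
      k * N′ / (P n * v n)
        ≈⟨ *-assoc _ _ _ ⟩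
      k * b n ∎
      where
      N₁ D₁ N′ : Carrier
      N₁ = thetaNum q t (suc n)
      D₁ = P (suc n) * u (suc n)
      N′ = thetaNum q w n

      cross : (1# - w) * (q ^ suc n - 1#) * N₁ * (P n * v n) ≈ k * N′ * D₁
      cross = begin
        (1# - w) * (q ^ suc n - 1#) * N₁ * (P n * v n)
          ≈⟨ *-congʳ (*-congˡ (thetaNum-suc q t n)) ⟩
        (1# - w) * (q ^ suc n - 1#) * - (k * N′) * (P n * v n)
          ≈⟨ solve 6 (λ t q qⁿ N′ p v →
               (con 1ℤ :- t :* q) :* (q :* qⁿ :- con 1ℤ) :* :- (t :* (con 1ℤ :- q) :* (con 1ℤ :- q) :* N′) :* (p :* v)
               := t :* (con 1ℤ :- q) :* (con 1ℤ :- q) :* N′ :* (p :* (con 1ℤ :- q :* qⁿ) :* ((con 1ℤ :- t :* q) :* v)))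
               refl t q (q ^ n) N′ (P n) (v n) ⟩
        k * N′ * (P (suc n) * ((1# - w) * v n))
          ≈⟨ *-congˡ (*-congˡ (poch-shift w q n)) ⟨
        k * N′ * D₁ ∎

    module Coefficients (μ : Series)
      (θ⊛μ≈θ′ : ∀ n → sumTo (suc n) (λ k → thetaCoeff q t k * μ (n ℕ.∸ k)) ≈ thetaCoeff q (t * q) n) where

      μ₀≈1 : μ 0 ≈ 1#
      μ₀≈1 = begin
        μ 0            ≈⟨ *-identityˡ _ ⟨
        1# * μ 0       ≈⟨ *-congʳ (thetaCoeff-zero q t) ⟨
        a 0 * μ 0      ≈⟨ +-identityˡ _ ⟨
        0# + a 0 * μ 0 ≈⟨ θ⊛μ≈θ′ 0 ⟩
        b 0            ≈⟨ thetaCoeff-zero q w ⟩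
        1#             ∎

      riccati≋0 : riccati (const w) (const k) X μ (dilate q μ) ≋ 𝟘
      riccati≋0 = ⊛≋0⇒≋0 a⊛a′₀≈1 (quotient-riccati a⊛μ≋b a′⊛μ′≋b′ split step)
        where
        a⊛a′₀≈1 : (a ⊛ dilate q a) 0 ≈ 1#
        a⊛a′₀≈1 = trans (*-cong (thetaCoeff-zero q t) (trans (*-identityˡ _) (thetaCoeff-zero q t))) (*-identityˡ 1#)

        a⊛μ≋b : a ⊛ μ ≋ b
        a⊛μ≋b n = trans (⊛-sumTo a μ n) (θ⊛μ≈θ′ n)

        a′⊛μ′≋b′ : dilate q a ⊛ dilate q μ ≋ dilate q b
        a′⊛μ′≋b′ n = trans (sym (dilate-⊛ q a μ n)) (*-congˡ (a⊛μ≋b n))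

        split : (const 1# ⊖ const w) ⊛ dilate q a ⊕ const w ⊛ dilate q b ≋ b
        split n = trans (+-cong (const-⊖-⊛ 1# w (dilate q a) n) (const-⊛ w (dilate q b) n)) (θ-split n)

        step : (const 1# ⊖ const w) ⊛ (dilate q a ⊖ a) ≋ const k ⊛ (X ⊛ b)
        step zero    = solve 4 (λ w k a₀ b₀ → (con 1ℤ :- w) :* (con 1ℤ :* a₀ :- a₀) := k :* (con 0ℤ :* b₀))
                         refl w k (a 0) (b 0)
        step (suc n) = begin
          ((const 1# ⊖ const w) ⊛ (dilate q a ⊖ a)) (suc n) ≈⟨ const-⊖-⊛ 1# w (dilate q a ⊖ a) (suc n) ⟩
          (1# - w) * (q ^ suc n * a (suc n) - a (suc n))    ≈⟨ θ-step n ⟩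
          k * b n                                           ≈⟨ trans (const-⊛ k (X ⊛ b) (suc n)) (*-congˡ (X-⊛ b n)) ⟨
          (const k ⊛ (X ⊛ b)) (suc n)                       ∎

      ρ : ℕ → Carrier
      ρ n = (1# - w) * μ n + w * (dilate q μ ⊛ μ) n

      riccati-coefficient : ∀ n → (1# - w) * (1# - w * q ^ suc n) * μ (suc n) ≈ k * ρ n
      riccati-coefficient n = x∙y⁻¹≈ε⇒x≈y _ _ (begin
        (1# - w) * (1# - w * q ^ suc n) * μ (suc n) - k * ρ n
          ≈⟨ solve 6 (λ w k qⁿ⁺¹ μₙ₊₁ μₙ c →
               (con 1ℤ :- w) :* (con 1ℤ :- w :* qⁿ⁺¹) :* μₙ₊₁ :- k :* ((con 1ℤ :- w) :* μₙ :+ w :* c)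
               := (con 1ℤ :- w) :* (μₙ₊₁ :- con 0ℤ) :- w :* ((con 1ℤ :- w) :* (qⁿ⁺¹ :* μₙ₊₁ :- con 0ℤ))
                  :- k :* ((con 1ℤ :- w) :* μₙ :+ w :* c))
               refl w k (q ^ suc n) (μ (suc n)) (μ n) ((dilate q μ ⊛ μ) n) ⟩
        (1# - w) * (μ (suc n) - 0#) - w * ((1# - w) * (q ^ suc n * μ (suc n) - 0#))
          - k * ((1# - w) * μ n + w * (dilate q μ ⊛ μ) n)
          ≈⟨ +-cong (+-cong (const-⊖-⊛ 1# w _ (suc n))
                            (-‿cong (trans (const-⊛ w _ (suc n)) (*-congˡ (const-⊖-⊛ 1# w _ (suc n))))))
                    (-‿cong (trans (const-⊛ k _ (suc n)) (*-congˡ (trans (X-⊛ _ n)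
                            (+-cong (const-⊖-⊛ 1# w μ n) (const-⊛ w _ n)))))) ⟨
        riccati (const w) (const k) X μ (dilate q μ) (suc n)
          ≈⟨ riccati≋0 (suc n) ⟩
        0# ∎)

      ρ₀≈1 : ρ 0 ≈ 1#
      ρ₀≈1 = begin
        (1# - w) * μ 0 + w * (1# * μ 0 * μ 0)
          ≈⟨ +-cong (*-congˡ μ₀≈1) (*-congˡ (*-cong (*-congˡ μ₀≈1) μ₀≈1)) ⟩
        (1# - w) * 1# + w * (1# * 1# * 1#)
          ≈⟨ solve 1 (λ w → (con 1ℤ :- w) :* con 1ℤ :+ w :* (con 1ℤ :* con 1ℤ :* con 1ℤ) := con 1ℤ) refl w ⟩
        1# ∎

      ρ-suc : ∀ m → ρ (suc m) ≈ sumTo m (λ j → t * q ^ (j ℕ.+ 2) * μ (j ℕ.+ 1) * μ (m ℕ.∸ j))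
                                + (1# + t * q ^ suc (suc m)) * μ (suc m)
      ρ-suc m = begin
        (1# - w) * μ (suc m) + w * (dilate q μ ⊛ μ) (suc m)
          ≈⟨ +-congˡ (*-congˡ (⊛-suc-sumTo (dilate q μ) μ m)) ⟩
        (1# - w) * μ (suc m) + w * (1# * μ 0 * μ (suc m) + (Σ + q ^ suc m * μ (suc m) * μ 0))
          ≈⟨ +-congˡ (*-congˡ (+-cong (*-congʳ (*-congˡ μ₀≈1)) (+-congˡ (*-congˡ μ₀≈1)))) ⟩
        (1# - w) * μ (suc m) + w * (1# * 1# * μ (suc m) + (Σ + q ^ suc m * μ (suc m) * 1#))
          ≈⟨ solve 5 (λ t q qᵐ μₘ₊₁ Σ →
               (con 1ℤ :- t :* q) :* μₘ₊₁ :+ t :* q :* (con 1ℤ :* con 1ℤ :* μₘ₊₁ :+ (Σ :+ q :* qᵐ :* μₘ₊₁ :* con 1ℤ))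
               := t :* q :* Σ :+ (con 1ℤ :+ t :* (q :* (q :* qᵐ))) :* μₘ₊₁)
               refl t q (q ^ m) (μ (suc m)) Σ ⟩
        w * Σ + (1# + t * q ^ suc (suc m)) * μ (suc m)
          ≈⟨ +-congʳ (trans (*-distribˡ-sumTo w m _) (sumTo-cong m term)) ⟩
        sumTo m (λ j → t * q ^ (j ℕ.+ 2) * μ (j ℕ.+ 1) * μ (m ℕ.∸ j)) + (1# + t * q ^ suc (suc m)) * μ (suc m) ∎
        where
        Σ : Carrier
        Σ = sumTo m (λ j → q ^ suc j * μ (suc j) * μ (m ℕ.∸ j))

        term : ∀ j → w * (q ^ suc j * μ (suc j) * μ (m ℕ.∸ j)) ≈ t * q ^ (j ℕ.+ 2) * μ (j ℕ.+ 1) * μ (m ℕ.∸ j)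
        term j rewrite ℕ.+-comm j 2 | ℕ.+-comm j 1 =
          solve 5 (λ t q qʲ μⱼ₊₁ μₘ₋ⱼ → t :* q :* (q :* qʲ :* μⱼ₊₁ :* μₘ₋ⱼ) := t :* (q :* (q :* qʲ)) :* μⱼ₊₁ :* μₘ₋ⱼ)
            refl t q (q ^ j) (μ (suc j)) (μ (m ℕ.∸ j))

      μ₁ : μ 1 ≈ t / (qnum q (t * q ^ 1) * qnum q (t * q ^ 2))
      μ₁ = *≈⇒≈/ (*-≉0 (*-≉0 (1-tqⁿ⁺¹≉0 0) i≉0) (*-≉0 (1-tqⁿ⁺¹≉0 1) i≉0)) (begin
        (1# - t * q ^ 1) * i * ((1# - t * q ^ 2) * i) * μ 1
          ≈⟨ solve 4 (λ t q i μ₁ →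
               (con 1ℤ :- t :* (q :* con 1ℤ)) :* i :* ((con 1ℤ :- t :* (q :* (q :* con 1ℤ))) :* i) :* μ₁
               := i :* i :* ((con 1ℤ :- t :* q) :* (con 1ℤ :- t :* q :* (q :* con 1ℤ)) :* μ₁))
               refl t q i (μ 1) ⟩
        i * i * ((1# - w) * (1# - w * q ^ 1) * μ 1) ≈⟨ *-congˡ (riccati-coefficient 0) ⟩
        i * i * (k * ρ 0)                           ≈⟨ *-congˡ (trans (*-congˡ ρ₀≈1) (*-identityʳ k)) ⟩
        i * i * k                                   ≈⟨ i*i*k≈t ⟩
        t                                           ∎)
        where
        i≉0 : ¬ (i ≈ 0#)
        i≉0 i≈0 = 1≉0 (trans (sym (⁻¹-inverse _ 1-q≉0)) (trans (*-congˡ i≈0) (zeroʳ _)))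

      recurrence : ∀ m → t ⁻¹ * qnum q (t * q ^ 1) * qnum q (t * q ^ (m ℕ.+ 3)) * μ (m ℕ.+ 2)
                         ≈ sumTo m (λ j → t * q ^ (j ℕ.+ 2) * μ (j ℕ.+ 1) * μ (m ℕ.∸ j))
                           + (1# + t * q ^ (m ℕ.+ 2)) * μ (m ℕ.+ 1)
      recurrence m rewrite ℕ.+-comm m 3 | ℕ.+-comm m 2 | ℕ.+-comm m 1 = begin
        t ⁻¹ * ((1# - t * q ^ 1) * i) * ((1# - t * q ^ suc (suc (suc m))) * i) * μ (suc (suc m))
          ≈⟨ solve 6 (λ t⁻¹ t q i qᵐ μₘ₊₂ →
               t⁻¹ :* ((con 1ℤ :- t :* (q :* con 1ℤ)) :* i) :* ((con 1ℤ :- t :* (q :* (q :* (q :* qᵐ)))) :* i) :* μₘ₊₂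
               := t⁻¹ :* (i :* i :* ((con 1ℤ :- t :* q) :* (con 1ℤ :- t :* q :* (q :* (q :* qᵐ))) :* μₘ₊₂)))
               refl (t ⁻¹) t q i (q ^ m) (μ (suc (suc m))) ⟩
        t ⁻¹ * (i * i * ((1# - w) * (1# - w * q ^ suc (suc m)) * μ (suc (suc m))))
          ≈⟨ *-congˡ (*-congˡ (riccati-coefficient (suc m))) ⟩
        t ⁻¹ * (i * i * (k * ρ (suc m)))
          ≈⟨ *-congˡ (trans (sym (*-assoc _ _ _)) (*-congʳ i*i*k≈t)) ⟩
        t ⁻¹ * (t * ρ (suc m))
          ≈⟨ trans (sym (*-assoc _ _ _)) (trans (*-congʳ (⁻¹-inverseˡ t≉0)) (*-identityˡ _)) ⟩
        ρ (suc m)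
          ≈⟨ ρ-suc m ⟩
        sumTo m (λ j → t * q ^ (j ℕ.+ 2) * μ (j ℕ.+ 1) * μ (m ℕ.∸ j)) + (1# + t * q ^ suc (suc m)) * μ (suc m) ∎

proposition2p1 : ∀ {c ℓ} (F : Field c ℓ) →
    let open Field F
        open FieldDefs F
    in (q t : Carrier) →
       ¬ (t ≈ 0#) →
       (∀ n → ¬ ((1# - q ^ suc n) ≈ 0#)) →
       (∀ n → ¬ ((1# - t * q ^ suc n) ≈ 0#)) →
       (μ : ℕ → Carrier) →
       (∀ n → sumTo (suc n) (λ k → thetaCoeff q t k * μ (n ℕ.∸ k))
                ≈ thetaCoeff q (t * q) n) →
       (μ 0 ≈ 1#)
       × (μ 1 ≈ t / (qnum q (t * q ^ 1) * qnum q (t * q ^ 2)))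
       × (∀ m → (t ⁻¹) * qnum q (t * q ^ 1) * qnum q (t * q ^ (m ℕ.+ 3)) * μ (m ℕ.+ 2)
                ≈ sumTo m (λ j → t * q ^ (j ℕ.+ 2) * μ (j ℕ.+ 1) * μ (m ℕ.∸ j))
                  + (1# + t * q ^ (m ℕ.+ 2)) * μ (m ℕ.+ 1))
proposition2p1 F q t t≉0 1-qⁿ⁺¹≉0 1-tqⁿ⁺¹≉0 μ θ⊛μ≈θ′ = μ₀≈1 , μ₁ , recurrence
  where open Theta.Ratio.Coefficients F q t t≉0 1-qⁿ⁺¹≉0 1-tqⁿ⁺¹≉0 μ θ⊛μ≈θ′
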